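{- Let $g$ be a positive integer and let $p$ be a prime number with $p\equiv1\pmod g$. Then $$f_2\Big(\frac{p^2-p}{g},g\Big)\ge p-1.$$
   Context: For positive integers $N$, $h\ge2$, $g$, $f_h(N,g):=\max\{|A|: A\subseteq\mathbb{Z}_N,\ A\in B_h[g](\mathbb{Z}_N)\}$, where $A\in B_h[g](\mathbb{Z}_N)$ means every $b\in\mathbb{Z}_N$ has at most $g$ distinct representations $b=a_1+\cdots+a_h$ with $a_i\in A$, counted up to reordering of the summands. -}

module Defs where

open import Data.Nat using (ℕ; zero; suc; _≤_; _≡ᵇ_)
open import Data.Nat.DivMod using (_%_)
open import Data.Fin using (Fin; toℕ)
open import Data.List using (List; []; _∷_; map; _++_; length; filter)
open import Data.Nat.ListAction using (sum)
open import Data.Bool using (Bool; T)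
open import Relation.Nullary.Decidable using (Dec)
open import Data.Bool.Properties using (T?)

-- Multisets of size h drawn from the list xs (combinations with repetition),
-- each given as a list whose elements appear in the order of xs.
-- If xs has no duplicates, these are exactly the representations
-- a₁ + ⋯ + a_h counted up to reordering of the summands.
multisets : {X : Set} → ℕ → List X → List (List X)
multisets zero    _        = [] ∷ []
multisets (suc h) []       = []
multisets (suc h) (x ∷ xs) = map (x ∷_) (multisets h (x ∷ xs)) ++ multisets (suc h) xs

sumsTo : (N : ℕ) → List (Fin N) → Fin N → Bool
sumsTo zero    m ()
sumsTo (suc n) m b = (sum (map toℕ m) % suc n) ≡ᵇ toℕ b

reps : (N h : ℕ) → List (Fin N) → Fin N → ℕ
reps N h A b = length (filter (λ m → T? (sumsTo N m b)) (multisets h A))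

IsBhg : (N h g : ℕ) → List (Fin N) → Set
IsBhg N h g A = (b : Fin N) → reps N h A b ≤ g

module Submission where

-- Let r be a primitive root modulo p, m = (p − 1)/g, and aᵢ = m·(rⁱ mod p) + p·i reduced modulo pm,
-- for 0 ≤ i < p − 1. By the Chinese remainder theorem aᵢ + aⱼ determines rⁱ + rʲ modulo p and i + j
-- modulo m. Among the representations of a fixed b the value ⌊((i + j) mod (p − 1))/m⌋ < g separates
-- them: two representations agreeing on it have i + j ≡ i′ + j′ modulo p − 1, hence rⁱ rʲ ≡ rⁱ′ rʲ′,
-- and {rⁱ, rʲ} = {rⁱ′, rʲ′} as the roots of one quadratic modulo p.
-- The primitive root is built as usual: Fermat's little theorem and the bound on the number of roots
-- of X^e − 1 give elements of each prime-power order dividing p − 1, and coprime orders multiply.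

module Congruence where

  open import Data.Nat as ℕ using (ℕ; zero; suc; NonZero; _<_; _≤_; _∸_)
  import Data.Nat.Properties as ℕₚ
  import Data.Nat.Divisibility as ℕᵈ
  open import Data.Nat.DivMod using (_%_; _/_; m≡m%n+[m/n]*n; m%n<n)
  open import Data.Nat.Coprimality using (Coprime; coprime-divisor)
  open import Data.Nat.Primality using (Prime; euclidsLemma; prime⇒irreducible; ¬prime[1])
  open import Data.Integer using (ℤ; +_; _+_; _-_; -_; _*_; _^_; 0ℤ; 1ℤ; ∣_∣)
  import Data.Integer.Properties as ℤₚ
  import Data.Integer.Divisibility.Signed as ℤᵈ
  open import Data.Integer.DivMod using (_%ℕ_; _/ℕ_; a≡a%ℕn+[a/ℕn]*n)
  open import Data.Integer.Tactic.RingSolver using (solve-∀)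
  open import Data.Product using (_×_; _,_)
  open import Data.Sum using (_⊎_; inj₁; inj₂)
  open import Data.Empty using (⊥-elim)
  open import Relation.Nullary using (¬_; map′)
  open import Relation.Binary using (Setoid; IsEquivalence; Decidable)
  import Relation.Binary.Reasoning.Setoid as SetoidReasoning
  open import Relation.Binary.PropositionalEquality

  infix 4 _≡_mod_
  record _≡_mod_ (a b : ℤ) (n : ℕ) : Set where
    constructor ∣⇒≡mod
    field ≡mod⇒∣ : + n ℤᵈ.∣ a - b
  open _≡_mod_ public

  a-b≡a∸b : ∀ {a b} → b ≤ a → + a - + b ≡ + (a ∸ b)
  a-b≡a∸b {a} {b} b≤a = trans (ℤₚ.m-n≡m⊖n a b) (ℤₚ.⊖-≥ b≤a)

  module _ {n : ℕ} where

    ≡mod-reflexive : ∀ {a b} → a ≡ b → a ≡ b mod n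
    ≡mod-reflexive {a} refl = ∣⇒≡mod (subst (+ n ℤᵈ.∣_) (sym (ℤₚ.+-inverseʳ a)) (ℤᵈ.divides 0ℤ refl))

    ≡mod-refl : ∀ {a} → a ≡ a mod n
    ≡mod-refl = ≡mod-reflexive refl

    ≡mod-sym : ∀ {a b} → a ≡ b mod n → b ≡ a mod n
    ≡mod-sym {a} {b} (∣⇒≡mod n∣a-b) = ∣⇒≡mod (subst (+ n ℤᵈ.∣_) (lemma a b) (ℤᵈ.∣m⇒∣-m n∣a-b))
      where lemma : ∀ a b → - (a - b) ≡ b - a
            lemma = solve-∀

    ≡mod-trans : ∀ {a b c} → a ≡ b mod n → b ≡ c mod n → a ≡ c mod n
    ≡mod-trans {a} {b} {c} (∣⇒≡mod n∣a-b) (∣⇒≡mod n∣b-c) =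
      ∣⇒≡mod (subst (+ n ℤᵈ.∣_) (lemma a b c) (ℤᵈ.∣m∣n⇒∣m+n n∣a-b n∣b-c))
      where lemma : ∀ a b c → (a - b) + (b - c) ≡ a - c
            lemma = solve-∀

    +-cong-≡mod : ∀ {a b c d} → a ≡ b mod n → c ≡ d mod n → a + c ≡ b + d mod n
    +-cong-≡mod {a} {b} {c} {d} (∣⇒≡mod n∣a-b) (∣⇒≡mod n∣c-d) =
      ∣⇒≡mod (subst (+ n ℤᵈ.∣_) (lemma a b c d) (ℤᵈ.∣m∣n⇒∣m+n n∣a-b n∣c-d))
      where lemma : ∀ a b c d → (a - b) + (c - d) ≡ (a + c) - (b + d)
            lemma = solve-∀

    *-cong-≡mod : ∀ {a b c d} → a ≡ b mod n → c ≡ d mod n → a * c ≡ b * d mod n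
    *-cong-≡mod {a} {b} {c} {d} (∣⇒≡mod n∣a-b) (∣⇒≡mod n∣c-d) =
      ∣⇒≡mod (subst (+ n ℤᵈ.∣_) (lemma a b c d) (ℤᵈ.∣m∣n⇒∣m+n (ℤᵈ.∣m⇒∣m*n c n∣a-b) (ℤᵈ.∣n⇒∣m*n b n∣c-d)))
      where lemma : ∀ a b c d → (a - b) * c + b * (c - d) ≡ a * c - b * d
            lemma = solve-∀

    ^-cong-≡mod : ∀ {a b} → a ≡ b mod n → ∀ k → a ^ k ≡ b ^ k mod n
    ^-cong-≡mod a≡b zero    = ≡mod-refl
    ^-cong-≡mod a≡b (suc k) = *-cong-≡mod a≡b (^-cong-≡mod a≡b k)

    ≡mod-isEquivalence : IsEquivalence (_≡_mod n)
    ≡mod-isEquivalence = record { refl = ≡mod-refl ; sym = ≡mod-sym ; trans = ≡mod-trans }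

    infix 4 _≡mod?_
    _≡mod?_ : Decidable (_≡_mod n)
    a ≡mod? b = map′ ∣⇒≡mod ≡mod⇒∣ (+ n ℤᵈ.∣? (a - b))

    ≡mod-setoid : Setoid _ _
    ≡mod-setoid = record { isEquivalence = ≡mod-isEquivalence }

    ∣⇒≡0-mod : ∀ {a} → + n ℤᵈ.∣ a → a ≡ 0ℤ mod n
    ∣⇒≡0-mod {a} n∣a = ∣⇒≡mod (subst (+ n ℤᵈ.∣_) (sym (ℤₚ.+-identityʳ a)) n∣a)

    ≡0-mod⇒∣ : ∀ {a} → a ≡ 0ℤ mod n → + n ℤᵈ.∣ a
    ≡0-mod⇒∣ {a} (∣⇒≡mod n∣a-0) = subst (+ n ℤᵈ.∣_) (ℤₚ.+-identityʳ a) n∣a-0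

    -≡0⇒≡-mod : ∀ {a b} → a - b ≡ 0ℤ mod n → a ≡ b mod n
    -≡0⇒≡-mod a-b≡0 = ∣⇒≡mod (≡0-mod⇒∣ a-b≡0)

    ≡⇒-≡0-mod : ∀ {a b} → a ≡ b mod n → a - b ≡ 0ℤ mod n
    ≡⇒-≡0-mod a≡b = ∣⇒≡0-mod (≡mod⇒∣ a≡b)

    +-multiple-≡mod : ∀ a k → a + + n * k ≡ a mod n
    +-multiple-≡mod a k = ≡mod-trans (+-cong-≡mod {a = a} ≡mod-refl n*k≡0) (≡mod-reflexive (ℤₚ.+-identityʳ a))
      where n*k≡0 : + n * k ≡ 0ℤ mod n
            n*k≡0 = ∣⇒≡0-mod (ℤᵈ.∣m⇒∣m*n k ℤᵈ.∣-refl)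

    sum-cancel-≡mod : ∀ {x y x′ y′} → x + y ≡ x′ + y′ mod n → x′ ≡ x mod n → y′ ≡ y mod n
    sum-cancel-≡mod {x} {y} {x′} {y′} (∣⇒≡mod n∣sums) (∣⇒≡mod n∣x′-x) =
      ∣⇒≡mod (subst (+ n ℤᵈ.∣_) (lemma x y x′ y′) (ℤᵈ.∣m∣n⇒∣m-n (ℤᵈ.∣m⇒∣-m n∣sums) n∣x′-x))
      where lemma : ∀ x y x′ y′ → - ((x + y) - (x′ + y′)) - (x′ - x) ≡ y′ - y
            lemma = solve-∀

    ≡mod-∣ : ∀ {m a b} → m ℕᵈ.∣ n → a ≡ b mod n → a ≡ b mod m
    ≡mod-∣ m∣n (∣⇒≡mod n∣a-b) = ∣⇒≡mod (ℤᵈ.∣-trans (ℤᵈ.∣ᵤ⇒∣ m∣n) n∣a-b)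

    *-cancelˡ-≡mod : ∀ {k a b} → Coprime n ∣ k ∣ → k * a ≡ k * b mod n → a ≡ b mod n
    *-cancelˡ-≡mod {k} {a} {b} n⊥k (∣⇒≡mod n∣ka-kb) = ∣⇒≡mod (ℤᵈ.∣ᵤ⇒∣ (coprime-divisor n⊥k n∣∣k∣*∣a-b∣))
      where
        lemma : ∀ k a b → k * a - k * b ≡ k * (a - b)
        lemma = solve-∀
        n∣∣k∣*∣a-b∣ : n ℕᵈ.∣ ∣ k ∣ ℕ.* ∣ a - b ∣
        n∣∣k∣*∣a-b∣ = subst (n ℕᵈ.∣_) (ℤₚ.abs-* k (a - b)) (ℤᵈ.∣⇒∣ᵤ (subst (+ n ℤᵈ.∣_) (lemma k a b) n∣ka-kb))

    %ℕ-≡mod : ∀ a .{{_ : NonZero n}} → + (a %ℕ n) ≡ a mod n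
    %ℕ-≡mod a = begin
      + (a %ℕ n)                    ≈⟨ +-multiple-≡mod (+ (a %ℕ n)) (a /ℕ n) ⟨
      + (a %ℕ n) + + n * (a /ℕ n)   ≡⟨ cong (λ x → + (a %ℕ n) + x) (ℤₚ.*-comm (+ n) (a /ℕ n)) ⟩
      + (a %ℕ n) + (a /ℕ n) * + n   ≡⟨ a≡a%ℕn+[a/ℕn]*n a n ⟨
      a                             ∎
      where open SetoidReasoning ≡mod-setoid

    %-≡mod : ∀ a .{{_ : NonZero n}} → + (a % n) ≡ + a mod n
    %-≡mod a = %ℕ-≡mod (+ a)

    %≡⇒≡mod : ∀ {a b} .{{_ : NonZero n}} → a % n ≡ b % n → + a ≡ + b mod n
    %≡⇒≡mod {a} {b} a%n≡b%n =
      ≡mod-trans (≡mod-sym (%-≡mod a)) (≡mod-trans (≡mod-reflexive (cong +_ a%n≡b%n)) (%-≡mod b))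

    ≡mod⇒∣∸ : ∀ {a b} → b ≤ a → + a ≡ + b mod n → n ℕᵈ.∣ a ∸ b
    ≡mod⇒∣∸ {a} {b} b≤a (∣⇒≡mod n∣a-b) = ℤᵈ.∣⇒∣ᵤ (subst (+ n ℤᵈ.∣_) (a-b≡a∸b b≤a) n∣a-b)

    ∣∸⇒≡mod : ∀ {a b} → b ≤ a → n ℕᵈ.∣ a ∸ b → + a ≡ + b mod n
    ∣∸⇒≡mod {a} {b} b≤a n∣a∸b = ∣⇒≡mod (subst (+ n ℤᵈ.∣_) (sym (a-b≡a∸b b≤a)) (ℤᵈ.∣ᵤ⇒∣ n∣a∸b))

    private
      ≡mod⇒≡-≤ : ∀ {a b} → a < n → b ≤ a → + a ≡ + b mod n → a ≡ b
      ≡mod⇒≡-≤ {a} {b} a<n b≤a a≡b =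
        ℕₚ.≤-antisym (ℕₚ.m∸n≡0⇒m≤n (small (ℕₚ.≤-<-trans (ℕₚ.m∸n≤m a b) a<n) (≡mod⇒∣∸ b≤a a≡b))) b≤a
        where
          small : ∀ {x} → x < n → n ℕᵈ.∣ x → x ≡ 0
          small {zero}  _   _   = refl
          small {suc x} x<n n∣x = ⊥-elim (ℕᵈ.>⇒∤ x<n n∣x)

    ≡mod⇒≡ : ∀ {a b} → a < n → b < n → + a ≡ + b mod n → a ≡ b
    ≡mod⇒≡ {a} {b} a<n b<n a≡b with ℕₚ.≤-total b a
    ... | inj₁ b≤a = ≡mod⇒≡-≤ a<n b≤a a≡b
    ... | inj₂ a≤b = sym (≡mod⇒≡-≤ b<n a≤b (≡mod-sym a≡b))

    <⇒≢0-mod : ∀ {x} → 0 < x → x < n → ¬ + x ≡ 0ℤ mod n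
    <⇒≢0-mod 0<x x<n x≡0 = ℕₚ.<⇒≢ 0<x (sym (≡mod⇒≡ x<n (ℕₚ.<-trans 0<x x<n) x≡0))

    ≡mod∧/≡⇒≡ : ∀ {a b} .{{_ : NonZero n}} → + a ≡ + b mod n → a / n ≡ b / n → a ≡ b
    ≡mod∧/≡⇒≡ {a} {b} a≡b a/n≡b/n = begin-equality
      a                      ≡⟨ m≡m%n+[m/n]*n a n ⟩
      a % n ℕ.+ a / n ℕ.* n  ≡⟨ cong₂ (λ x y → x ℕ.+ y ℕ.* n) a%n≡b%n a/n≡b/n ⟩
      b % n ℕ.+ b / n ℕ.* n  ≡⟨ m≡m%n+[m/n]*n b n ⟨
      b                      ∎
      where
        open ℕₚ.≤-Reasoning
        a%n≡b%n : a % n ≡ b % n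
        a%n≡b%n = ≡mod⇒≡ (m%n<n a n) (m%n<n b n)
                    (≡mod-trans (%-≡mod a) (≡mod-trans a≡b (≡mod-sym (%-≡mod b))))

  prime∤⇒coprime : ∀ {p n} → Prime p → ¬ p ℕᵈ.∣ n → Coprime p n
  prime∤⇒coprime p-prime p∤n (d∣p , d∣n) with prime⇒irreducible p-prime d∣p
  ... | inj₁ d≡1 = d≡1
  ... | inj₂ refl = ⊥-elim (p∤n d∣n)

  module _ {p : ℕ} (p-prime : Prime p) where

    1≢0-mod : ¬ 1ℤ ≡ 0ℤ mod p
    1≢0-mod 1≡0 = ¬prime[1] (subst Prime (ℕᵈ.∣1⇒≡1 (ℤᵈ.∣⇒∣ᵤ (≡0-mod⇒∣ 1≡0))) p-prime)

    ≢0-mod⇒coprime : ∀ {a} → ¬ a ≡ 0ℤ mod p → Coprime p ∣ a ∣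
    ≢0-mod⇒coprime a≢0 = prime∤⇒coprime p-prime (λ p∣a → a≢0 (∣⇒≡0-mod (ℤᵈ.∣ᵤ⇒∣ p∣a)))

    *≡0⇒≡0⊎≡0-mod : ∀ {a b} → a * b ≡ 0ℤ mod p → a ≡ 0ℤ mod p ⊎ b ≡ 0ℤ mod p
    *≡0⇒≡0⊎≡0-mod {a} {b} ab≡0
      with euclidsLemma ∣ a ∣ ∣ b ∣ p-prime (subst (p ℕᵈ.∣_) (ℤₚ.abs-* a b) (ℤᵈ.∣⇒∣ᵤ (≡0-mod⇒∣ ab≡0)))
    ... | inj₁ p∣a = inj₁ (∣⇒≡0-mod (ℤᵈ.∣ᵤ⇒∣ p∣a))
    ... | inj₂ p∣b = inj₂ (∣⇒≡0-mod (ℤᵈ.∣ᵤ⇒∣ p∣b))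

    -- x′ is a root of (X − x)(X − y), whose coefficients agree modulo p with those of (X − x′)(X − y′).
    vieta-≡mod : ∀ {x y x′ y′} → x + y ≡ x′ + y′ mod p → x * y ≡ x′ * y′ mod p →
                 (x′ ≡ x mod p × y′ ≡ y mod p) ⊎ (x′ ≡ y mod p × y′ ≡ x mod p)
    vieta-≡mod {x} {y} {x′} {y′} sums@(∣⇒≡mod p∣sums) (∣⇒≡mod p∣products)
      with *≡0⇒≡0⊎≡0-mod {x′ - x} {x′ - y} (∣⇒≡0-mod root)
      where
        lemma : ∀ x y x′ y′ → - x′ * ((x + y) - (x′ + y′)) + (x * y - x′ * y′) ≡ (x′ - x) * (x′ - y)
        lemma = solve-∀
        root : + p ℤᵈ.∣ (x′ - x) * (x′ - y)
        root = subst (+ p ℤᵈ.∣_) (lemma x y x′ y′) (ℤᵈ.∣m∣n⇒∣m+n (ℤᵈ.∣n⇒∣m*n (- x′) p∣sums) p∣products)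
    ... | inj₁ x′-x≡0 = let x′≡x = -≡0⇒≡-mod x′-x≡0 in inj₁ (x′≡x , sum-cancel-≡mod sums x′≡x)
    ... | inj₂ x′-y≡0 = let x′≡y = -≡0⇒≡-mod x′-y≡0
                        in inj₂ (x′≡y , sum-cancel-≡mod (≡mod-trans (≡mod-reflexive (ℤₚ.+-comm y x)) sums) x′≡y)

module Fermat where

  open import Data.Nat as ℕ using (ℕ; zero; suc; _+_; _*_; _∸_; _^_; _<_; _!; z≤n; s≤s; NonZero)
  import Data.Nat.Properties as ℕₚ
  open import Data.Nat.Divisibility using (_∣_; ∣-refl; ∣m⇒∣m*n; ∣⇒≤; ∣1⇒≡1)
  open import Data.Nat.DivMod using (_%_; m/n*n≡m; %-distribˡ-+; %-remove-+ˡ)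
  open import Data.Nat.Primality using (Prime; euclidsLemma; prime⇒nonZero; prime⇒nonTrivial)
  open import Data.Nat.Combinatorics using (_C_; nCn≡1; k![n∸k]!∣n!)
  open import Data.Nat.Combinatorics.Specification using (nCk≡n!/k![n-k]!)
  open import Data.Fin using (Fin; zero; suc; toℕ; fromℕ; inject₁)
  import Data.Fin.Properties as Finₚ
  open import Data.Sum using (inj₁; inj₂)
  open import Relation.Nullary using (¬_; contradiction)
  open import Relation.Binary.PropositionalEquality
  open import Algebra.Definitions.RawMonoid ℕ.+-0-rawMonoid as Monoid using (sum)
  import Algebra.Definitions.RawSemiring ℕ.+-*-rawSemiring as Semiring
  import Algebra.Properties.CommutativeSemiring.Binomial ℕₚ.+-*-commutativeSemiring as Binomial

  -- The binomial theorem of the algebra library is stated with the generic multiple and power.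
  ×≡* : ∀ k x → k Monoid.× x ≡ k * x
  ×≡* zero    x = refl
  ×≡* (suc k) x = cong (x +_) (×≡* k x)

  ^≡^ : ∀ x k → x Semiring.^ k ≡ x ^ k
  ^≡^ x zero    = refl
  ^≡^ x (suc k) = cong (x *_) (^≡^ x k)

  n∣n! : ∀ n .{{_ : NonZero n}} → n ∣ n !
  n∣n! (suc n) = ∣m⇒∣m*n (n !) ∣-refl

  0^n≡0 : ∀ n .{{_ : NonZero n}} → 0 ^ n ≡ 0
  0^n≡0 (suc n) = refl

  +-congˡ-% : ∀ a {b c d} .{{_ : NonZero d}} → b % d ≡ c % d → (a + b) % d ≡ (a + c) % d
  +-congˡ-% a {b} {c} {d} b%d≡c%d = begin
    (a + b) % d             ≡⟨ %-distribˡ-+ a b d ⟩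
    (a % d + b % d) % d     ≡⟨ cong (λ y → (a % d + y) % d) b%d≡c%d ⟩
    (a % d + c % d) % d     ≡⟨ %-distribˡ-+ a c d ⟨
    (a + c) % d             ∎
    where open ≡-Reasoning

  prime∤! : ∀ {p k} → Prime p → k < p → ¬ p ∣ k !
  prime∤! {p} {zero}  p-prime _   p∣1 =
    contradiction (∣1⇒≡1 p∣1) (ℕₚ.>⇒≢ (ℕ.nonTrivial⇒n>1 p {{prime⇒nonTrivial p-prime}}))
  prime∤! {p} {suc k} p-prime k<p p∣k! with euclidsLemma (suc k) (k !) p-prime p∣k!
  ... | inj₁ p∣1+k = ℕₚ.<⇒≱ k<p (∣⇒≤ p∣1+k)
  ... | inj₂ p∣k!  = prime∤! p-prime (ℕₚ.<-trans (ℕₚ.n<1+n k) k<p) p∣k!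

  -- p divides p! = (p C k) k! (p − k)!, but neither k! nor (p − k)!.
  prime∣C : ∀ {p k} → Prime p → 0 < k → k < p → p ∣ p C k
  prime∣C {p} {k} p-prime 0<k k<p
    with euclidsLemma (p C k) (k ! * (p ∸ k) !) p-prime (subst (p ∣_) (sym factorials) (n∣n! p {{prime⇒nonZero p-prime}}))
    where
      instance _ = k ℕₚ.!* (p ∸ k) !≢0
      factorials : (p C k) * (k ! * (p ∸ k) !) ≡ p !
      factorials = trans (cong (_* (k ! * (p ∸ k) !)) (nCk≡n!/k![n-k]! (ℕₚ.<⇒≤ k<p)))
                         (m/n*n≡m (k![n∸k]!∣n! (ℕₚ.<⇒≤ k<p)))
  ... | inj₁ p∣C = p∣C
  ... | inj₂ p∣k![p∸k]! with euclidsLemma (k !) ((p ∸ k) !) p-prime p∣k![p∸k]!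
  ... | inj₁ p∣k!      = contradiction p∣k! (prime∤! p-prime k<p)
  ... | inj₂ p∣[p∸k]!  = contradiction p∣[p∸k]! (prime∤! p-prime (ℕₚ.∸-monoʳ-< 0<k (ℕₚ.<⇒≤ k<p)))

  sum-%-last : ∀ {d} .{{_ : NonZero d}} n (t : Fin (suc n) → ℕ) → (∀ i → d ∣ t (inject₁ i)) →
               sum t % d ≡ t (fromℕ n) % d
  sum-%-last {d} zero    t _   = cong (_% d) (ℕₚ.+-identityʳ (t zero))
  sum-%-last {d} (suc n) t d∣t = trans (%-remove-+ˡ (sum (λ i → t (suc i))) (d∣t zero))
                                       (sum-%-last n (λ i → t (suc i)) (λ i → d∣t (suc i)))

  freshman's-dream : ∀ {p} .{{_ : NonZero p}} → Prime p → ∀ x → (x + 1) ^ p % p ≡ (1 + x ^ p) % p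
  freshman's-dream {zero} ()
  freshman's-dream {p@(suc p′)} p-prime x = begin
    (x + 1) ^ p % p                    ≡⟨ cong (_% p) (^≡^ (x + 1) p) ⟨
    (x + 1) Semiring.^ p % p           ≡⟨ cong (_% p) (Binomial.theorem p x 1) ⟩
    (term zero + sum inner) % p        ≡⟨ cong (λ y → (y + sum inner) % p) first ⟩
    (1 + sum inner) % p                ≡⟨ +-congˡ-% 1 {sum inner} {x ^ p} {p} inner≡last ⟩
    (1 + x ^ p) % p                    ∎
    where
      open ≡-Reasoning
      term : Fin (suc p) → ℕ
      term = Binomial.binomialTerm x 1 p
      inner : Fin p → ℕ
      inner i = term (suc i)
      term≡ : ∀ k → term k ≡ (p C toℕ k) * (x ^ toℕ k * 1 ^ (p ∸ toℕ k))
      term≡ k = trans (×≡* (p C toℕ k) _) (cong ((p C toℕ k) *_) (cong₂ _*_ (^≡^ x (toℕ k)) (^≡^ 1 (p ∸ toℕ k))))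
      first : term zero ≡ 1
      first = trans (term≡ zero) (cong (λ y → 1 * (1 * y)) (ℕₚ.^-zeroˡ p))
      last : term (fromℕ p) ≡ x ^ p
      last = begin
        term (fromℕ p)                               ≡⟨ term≡ (fromℕ p) ⟩
        (p C k) * (x ^ k * 1 ^ (p ∸ k))              ≡⟨ cong (λ k → (p C k) * (x ^ k * 1 ^ (p ∸ k))) (Finₚ.toℕ-fromℕ p) ⟩
        (p C p) * (x ^ p * 1 ^ (p ∸ p))              ≡⟨ cong₂ (λ c e → c * (x ^ p * 1 ^ e)) (nCn≡1 p) (ℕₚ.n∸n≡0 p) ⟩
        1 * (x ^ p * 1)                              ≡⟨ trans (ℕₚ.*-identityˡ _) (ℕₚ.*-identityʳ (x ^ p)) ⟩
        x ^ p                                        ∎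
        where
        k : ℕ
        k = toℕ (fromℕ p)
      p∣middle : ∀ i → p ∣ inner (inject₁ i)
      p∣middle i = subst (p ∣_) (sym (term≡ (suc (inject₁ i))))
                     (∣m⇒∣m*n _ (prime∣C p-prime (s≤s z≤n) (s≤s (subst (_< p′) (sym (Finₚ.toℕ-inject₁ i)) (Finₚ.toℕ<n i)))))
      inner≡last : sum inner % p ≡ x ^ p % p
      inner≡last = trans (sum-%-last p′ inner p∣middle) (cong (_% p) last)

  fermat : ∀ {p} .{{_ : NonZero p}} → Prime p → ∀ x → x ^ p % p ≡ x % p
  fermat {p} p-prime zero    = cong (_% p) (0^n≡0 p)
  fermat {p} p-prime (suc x) = begin
    suc x ^ p % p         ≡⟨ cong (λ y → y ^ p % p) (ℕₚ.+-comm 1 x) ⟩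
    (x + 1) ^ p % p       ≡⟨ freshman's-dream p-prime x ⟩
    (1 + x ^ p) % p       ≡⟨ +-congˡ-% 1 {x ^ p} {x} {p} (fermat p-prime x) ⟩
    suc x % p             ∎
    where open ≡-Reasoning

module RootBound where

  open import Data.Nat using (ℕ; zero; suc; _<_; _≤_; z≤n; s≤s)
  import Data.Nat.Properties as ℕₚ
  open import Data.Nat.Primality using (Prime)
  open import Data.Integer using (ℤ; +_; _+_; _-_; -_; _*_; _^_; 0ℤ; 1ℤ)
  import Data.Integer.Properties as ℤₚ
  open import Data.Integer.Tactic.RingSolver using (solve-∀)
  open import Data.List using (List; []; _∷_; length; map; replicate; applyUpTo)
  import Data.List.Properties as Listₚ
  open import Data.List.Relation.Unary.All as All using (All; []; _∷_; all?)
  import Data.List.Relation.Unary.All.Properties as Allₚ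
  open import Data.List.Relation.Unary.AllPairs using (AllPairs; []; _∷_)
  import Data.List.Relation.Unary.AllPairs.Properties as AllPairsₚ
  open import Data.List.Membership.Propositional using (find)
  open import Data.List.Membership.Propositional.Properties using (∈-applyUpTo⁻)
  open import Data.Product using (∃; _×_; _,_)
  open import Data.Sum using (inj₁; inj₂)
  open import Relation.Nullary using (¬_; yes; no; contradiction)
  open import Relation.Unary using (Decidable)
  open import Relation.Binary.PropositionalEquality

  open Congruence

  -- cs = [c₀, …, c_{d−1}] stands for the monic polynomial c₀ + c₁ X + ⋯ + c_{d−1} X^{d−1} + X^d.
  evalMonic : List ℤ → ℤ → ℤ
  evalMonic []       z = 1ℤ
  evalMonic (c ∷ cs) z = c + z * evalMonic cs z

  -- The quotient of c ∷ cs by X − a, which does not depend on c.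
  divideByRoot : ℤ → List ℤ → List ℤ
  divideByRoot a []       = []
  divideByRoot a (c ∷ cs) = evalMonic (c ∷ cs) a ∷ divideByRoot a cs

  length-divideByRoot : ∀ a cs → length (divideByRoot a cs) ≡ length cs
  length-divideByRoot a []       = refl
  length-divideByRoot a (c ∷ cs) = cong suc (length-divideByRoot a cs)

  evalMonic-divideByRoot : ∀ a c cs z →
    evalMonic (c ∷ cs) z - evalMonic (c ∷ cs) a ≡ (z - a) * evalMonic (divideByRoot a cs) z
  evalMonic-divideByRoot a c []        z = lemma c z a
    where lemma : ∀ c z a → (c + z * 1ℤ) - (c + a * 1ℤ) ≡ (z - a) * 1ℤ
          lemma = solve-∀
  evalMonic-divideByRoot a c (c′ ∷ cs) z = begin
    (c + z * f z) - (c + a * f a)                            ≡⟨ cong (λ y → (c + z * y) - (c + a * f a)) (move (evalMonic-divideByRoot a c′ cs z)) ⟩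
    (c + z * (f a + (z - a) * q z)) - (c + a * f a)          ≡⟨ lemma c z a (f a) (q z) ⟩
    (z - a) * (f a + z * q z)                                ∎
    where
      open ≡-Reasoning
      f q : ℤ → ℤ
      f = evalMonic (c′ ∷ cs)
      q = evalMonic (divideByRoot a cs)
      move : ∀ {x y w} → x - y ≡ w → x ≡ y + w
      move {x} {y} refl = sym (cancel x y)
        where cancel : ∀ x y → y + (x - y) ≡ x
              cancel = solve-∀
      lemma : ∀ c z a fa qz → (c + z * (fa + (z - a) * qz)) - (c + a * fa) ≡ (z - a) * (fa + z * qz)
      lemma = solve-∀

  module _ {p : ℕ} (p-prime : Prime p) where

    roots≤degree : ∀ cs rs → AllPairs (λ u v → ¬ u ≡ v mod p) rs →
                   All (λ r → evalMonic cs r ≡ 0ℤ mod p) rs → length rs ≤ length cs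
    roots≤degree cs       []       _            _             = z≤n
    roots≤degree []       (r ∷ rs) _            (1≡0 ∷ _)     = contradiction 1≡0 (1≢0-mod p-prime)
    roots≤degree (c ∷ cs) (r ∷ rs) (r≢rs ∷ rs≢) (fr≡0 ∷ frs≡0) =
      s≤s (subst (length rs ≤_) (length-divideByRoot r cs)
            (roots≤degree (divideByRoot r cs) rs rs≢ (quotient-roots r≢rs frs≡0)))
      where
        quotient-roots : ∀ {us} → All (λ u → ¬ r ≡ u mod p) us → All (λ u → evalMonic (c ∷ cs) u ≡ 0ℤ mod p) us →
                         All (λ u → evalMonic (divideByRoot r cs) u ≡ 0ℤ mod p) us
        quotient-roots []             []            = []
        quotient-roots {u ∷ _} (r≢u ∷ r≢us) (fu≡0 ∷ fus≡0)
          with *≡0⇒≡0⊎≡0-mod p-prime (≡mod-trans (≡mod-reflexive (sym (evalMonic-divideByRoot r c cs u)))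
                                                  (≡⇒-≡0-mod (≡mod-trans fu≡0 (≡mod-sym fr≡0))))
        ... | inj₁ u-r≡0 = contradiction (≡mod-sym (-≡0⇒≡-mod u-r≡0)) r≢u
        ... | inj₂ qu≡0  = qu≡0 ∷ quotient-roots r≢us fus≡0

  evalMonic-zeros : ∀ e z → evalMonic (replicate e 0ℤ) z ≡ z ^ e
  evalMonic-zeros zero    z = refl
  evalMonic-zeros (suc e) z = trans (ℤₚ.+-identityˡ _) (cong (z *_) (evalMonic-zeros e z))

  evalMonic-X^e-1 : ∀ e z → evalMonic (- 1ℤ ∷ replicate e 0ℤ) z ≡ z ^ suc e - 1ℤ
  evalMonic-X^e-1 e z = trans (cong (λ y → - 1ℤ + z * y) (evalMonic-zeros e z)) (ℤₚ.+-comm (- 1ℤ) (z ^ suc e))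

  module _ {p′ : ℕ} (p-prime : Prime (suc p′)) where

    private
      p : ℕ
      p = suc p′

      isRootOfUnity? : ∀ e → Decidable (λ x → (+ x) ^ e ≡ 1ℤ mod p)
      isRootOfUnity? e x = (+ x) ^ e ≡mod? 1ℤ

      nonzeroResidues : List ℕ
      nonzeroResidues = applyUpTo suc p′

      nonzeroResidues-distinct : AllPairs (λ u v → ¬ u ≡ v mod p) (map +_ nonzeroResidues)
      nonzeroResidues-distinct = AllPairsₚ.map⁺ (AllPairsₚ.applyUpTo⁺₁ suc p′ λ i<j j<p′ i≡j →
        ℕₚ.<⇒≢ i<j (ℕₚ.suc-injective (≡mod⇒≡ (s≤s (ℕₚ.<-trans i<j j<p′)) (s≤s j<p′) i≡j)))

      roots-of-unity≤ : ∀ e → All (λ x → (+ x) ^ suc e ≡ 1ℤ mod p) nonzeroResidues → p′ ≤ suc e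
      roots-of-unity≤ e all-roots =
        subst₂ _≤_ (trans (Listₚ.length-map +_ nonzeroResidues) (Listₚ.length-applyUpTo suc p′))
                   (cong suc (Listₚ.length-replicate e))
                   (roots≤degree p-prime (- 1ℤ ∷ replicate e 0ℤ) (map +_ nonzeroResidues) nonzeroResidues-distinct
                      (Allₚ.map⁺ (All.map (λ {x} x^e≡1 → ≡mod-trans (≡mod-reflexive (evalMonic-X^e-1 e (+ x))) (≡⇒-≡0-mod x^e≡1))
                                          all-roots)))

    -- X^e − 1 has at most e < p′ roots among the p′ distinct nonzero residues.
    ∃-non-root-of-unity : ∀ {e} → 0 < e → e < p′ → ∃ λ x → 0 < x × x < p × ¬ (+ x) ^ e ≡ 1ℤ mod p
    ∃-non-root-of-unity {suc e} _ e<p′ with all? (isRootOfUnity? (suc e)) nonzeroResidues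
    ... | yes all-roots = contradiction (roots-of-unity≤ e all-roots) (ℕₚ.<⇒≱ e<p′)
    ... | no ¬all-roots with find (Allₚ.¬All⇒Any¬ (isRootOfUnity? (suc e)) nonzeroResidues ¬all-roots)
    ... | x , x∈residues , x-non-root with ∈-applyUpTo⁻ suc x∈residues
    ... | i , i<p′ , refl = suc i , s≤s z≤n , s≤s i<p′ , x-non-root

module Orders where

  open import Data.Nat as ℕ using (ℕ; zero; suc; NonZero; _<_; _≤_; z≤n; s≤s; z<s)
  import Data.Nat.Properties as ℕₚ
  open import Data.Nat.Divisibility as ℕᵈ using (_∣_; divides; _∣?_)
  open import Data.Nat.GCD using (gcd; gcd-GCD; gcd[m,n]∣m; gcd[m,n]∣n; module Bézout)
  open import Data.Nat.LCM using (lcm; lcm-least; gcd*lcm)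
  open import Data.Nat.Coprimality as Coprimality using (Coprime; coprime-divisor; coprime⇒gcd≡1)
  open import Data.Nat.Primality using (Prime; prime⇒nonTrivial; prime⇒nonZero; prime⇒irreducible)
  open import Data.Nat.Primality.Factorisation using (factorise)
  open import Data.Nat.Induction using (<-rec)
  open import Data.Integer using (ℤ; +_; _*_; _^_; 0ℤ; 1ℤ)
  import Data.Integer.Properties as ℤₚ
  open import Data.Integer.Tactic.RingSolver using (solve-∀)
  open import Data.List using ([]; _∷_)
  open import Data.List.Relation.Unary.All using (_∷_)
  open import Data.Product using (∃; ∃₂; _×_; _,_; proj₁; proj₂)
  open import Data.Sum using (_⊎_; inj₁; inj₂)
  open import Relation.Nullary using (¬_; yes; no; contradiction)
  open import Relation.Binary.PropositionalEquality
  import Relation.Binary.Reasoning.Setoid as SetoidReasoning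

  open Congruence
  open Fermat using (fermat)
  open RootBound using (∃-non-root-of-unity)

  pos-^ : ∀ x k → + (x ℕ.^ k) ≡ (+ x) ^ k
  pos-^ x zero    = refl
  pos-^ x (suc k) = trans (ℤₚ.pos-* x (x ℕ.^ k)) (cong (+ x *_) (pos-^ x k))

  ^-distribʳ-* : ∀ a b k → (a * b) ^ k ≡ a ^ k * b ^ k
  ^-distribʳ-* a b zero    = refl
  ^-distribʳ-* a b (suc k) = trans (cong ((a * b) *_) (^-distribʳ-* a b k)) (lemma a b (a ^ k) (b ^ k))
    where lemma : ∀ a b x y → (a * b) * (x * y) ≡ (a * x) * (b * y)
          lemma = solve-∀

  0^n≡0 : ∀ n .{{_ : NonZero n}} → 0ℤ ^ n ≡ 0ℤ
  0^n≡0 (suc n) = refl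

  fermat-≡mod : ∀ {p′} → Prime (suc p′) → ∀ {x} → ¬ + x ≡ 0ℤ mod suc p′ → (+ x) ^ p′ ≡ 1ℤ mod suc p′
  fermat-≡mod {p′} p-prime {x} x≢0 = *-cancelˡ-≡mod {k = + x} (≢0-mod⇒coprime p-prime x≢0) (begin
    + x * (+ x) ^ p′   ≡⟨ pos-^ x (suc p′) ⟨
    + (x ℕ.^ suc p′)   ≈⟨ %≡⇒≡mod (fermat p-prime x) ⟩
    + x                ≡⟨ ℤₚ.*-identityʳ (+ x) ⟨
    + x * 1ℤ           ∎)
    where open SetoidReasoning (≡mod-setoid {suc p′})

  infix 4 _hasOrder_mod_
  _hasOrder_mod_ : ℤ → ℕ → ℕ → Set
  r hasOrder m mod n = r ^ m ≡ 1ℤ mod n × (∀ t → r ^ t ≡ 1ℤ mod n → m ∣ t)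

  coprime⇒*∣ : ∀ {s t u} → Coprime s t → s ∣ u → t ∣ u → s ℕ.* t ∣ u
  coprime⇒*∣ {s} {t} {u} s⊥t s∣u t∣u = subst (_∣ u) lcm≡s*t (lcm-least s∣u t∣u)
    where
      lcm≡s*t : lcm s t ≡ s ℕ.* t
      lcm≡s*t = trans (sym (ℕₚ.*-identityˡ (lcm s t)))
                      (trans (cong (ℕ._* lcm s t) (sym (coprime⇒gcd≡1 s⊥t))) (gcd*lcm s t))

  module _ {n : ℕ} where
    open SetoidReasoning (≡mod-setoid {n})

    ^≡1-∣ : ∀ {r m t} → r ^ m ≡ 1ℤ mod n → m ∣ t → r ^ t ≡ 1ℤ mod n
    ^≡1-∣ {r} {m} r^m≡1 (divides q refl) = begin
      r ^ (q ℕ.* m)   ≡⟨ cong (r ^_) (ℕₚ.*-comm q m) ⟩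
      r ^ (m ℕ.* q)   ≡⟨ ℤₚ.^-*-assoc r m q ⟨
      (r ^ m) ^ q     ≈⟨ ^-cong-≡mod r^m≡1 q ⟩
      1ℤ ^ q          ≡⟨ ℤₚ.^-zeroˡ q ⟩
      1ℤ              ∎

    *≡1-cancelʳ : ∀ {a b} → a * b ≡ 1ℤ mod n → b ≡ 1ℤ mod n → a ≡ 1ℤ mod n
    *≡1-cancelʳ {a} {b} ab≡1 b≡1 = begin
      a         ≡⟨ ℤₚ.*-identityʳ a ⟨
      a * 1ℤ    ≈⟨ *-cong-≡mod {a = a} ≡mod-refl (≡mod-sym b≡1) ⟩
      a * b     ≈⟨ ab≡1 ⟩
      1ℤ        ∎

    ^-+≡1-cancelʳ : ∀ {r s t} → r ^ (s ℕ.+ t) ≡ 1ℤ mod n → r ^ t ≡ 1ℤ mod n → r ^ s ≡ 1ℤ mod n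
    ^-+≡1-cancelʳ {r} {s} {t} r^[s+t]≡1 =
      *≡1-cancelʳ (subst (λ z → z ≡ 1ℤ mod n) (ℤₚ.^-distribˡ-+-* r s t) r^[s+t]≡1)

    ^≡1-gcd : ∀ {r s t} → r ^ s ≡ 1ℤ mod n → r ^ t ≡ 1ℤ mod n → r ^ gcd s t ≡ 1ℤ mod n
    ^≡1-gcd {r} {s} {t} r^s≡1 r^t≡1 with Bézout.identity (gcd-GCD s t)
    ... | Bézout.+- x y eq = ^-+≡1-cancelʳ {r} {gcd s t} {y ℕ.* t} (subst (λ e → r ^ e ≡ 1ℤ mod n) (sym eq) (^≡1-∣ {r} {s} r^s≡1 (ℕᵈ.n∣m*n x)))
                                           (^≡1-∣ {r} {t} r^t≡1 (ℕᵈ.n∣m*n y))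
    ... | Bézout.-+ x y eq = ^-+≡1-cancelʳ {r} {gcd s t} {x ℕ.* s} (subst (λ e → r ^ e ≡ 1ℤ mod n) (sym eq) (^≡1-∣ {r} {t} r^t≡1 (ℕᵈ.n∣m*n y)))
                                           (^≡1-∣ {r} {s} r^s≡1 (ℕᵈ.n∣m*n x))

    private
      order-∣ : ∀ {a b s t u} → a hasOrder s mod n → b ^ t ≡ 1ℤ mod n → Coprime s t →
                (a * b) ^ u ≡ 1ℤ mod n → s ∣ u
      order-∣ {a} {b} {s} {t} {u} (_ , s-least) b^t≡1 s⊥t [ab]^u≡1 =
        coprime-divisor s⊥t (subst (s ∣_) (ℕₚ.*-comm u t) (s-least (u ℕ.* t) a^ut≡1))
        where
          a^ut≡1 : a ^ (u ℕ.* t) ≡ 1ℤ mod n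
          a^ut≡1 = *≡1-cancelʳ {b = b ^ (u ℕ.* t)} (subst (λ z → z ≡ 1ℤ mod n) (^-distribʳ-* a b (u ℕ.* t)) (^≡1-∣ {a * b} {u} [ab]^u≡1 (ℕᵈ.m∣m*n t)))
                               (^≡1-∣ {b} {t} b^t≡1 (ℕᵈ.n∣m*n u))

    hasOrder-* : ∀ {a b s t} → a hasOrder s mod n → b hasOrder t mod n → Coprime s t →
                 a * b hasOrder s ℕ.* t mod n
    hasOrder-* {a} {b} {s} {t} a-order@(a^s≡1 , _) b-order@(b^t≡1 , _) s⊥t = [ab]^st≡1 , least
      where
        [ab]^st≡1 : (a * b) ^ (s ℕ.* t) ≡ 1ℤ mod n
        [ab]^st≡1 = begin
          (a * b) ^ (s ℕ.* t)                ≡⟨ ^-distribʳ-* a b (s ℕ.* t) ⟩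
          a ^ (s ℕ.* t) * b ^ (s ℕ.* t)      ≈⟨ *-cong-≡mod (^≡1-∣ {a} {s} a^s≡1 (ℕᵈ.m∣m*n t)) (^≡1-∣ {b} {t} b^t≡1 (ℕᵈ.n∣m*n s)) ⟩
          1ℤ                                 ∎
        least : ∀ u → (a * b) ^ u ≡ 1ℤ mod n → s ℕ.* t ∣ u
        least u [ab]^u≡1 =
          coprime⇒*∣ s⊥t (order-∣ a-order b^t≡1 s⊥t [ab]^u≡1)
                         (order-∣ b-order a^s≡1 (Coprimality.sym s⊥t) (subst (λ z → z ^ u ≡ 1ℤ mod n) (ℤₚ.*-comm a b) [ab]^u≡1))

  ∣prime^suc⇒≡⊎∣ : ∀ {q d} → Prime q → ∀ k → d ∣ q ℕ.^ suc k → d ≡ q ℕ.^ suc k ⊎ d ∣ q ℕ.^ k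
  ∣prime^suc⇒≡⊎∣ {q} {d} q-prime zero d∣q^1 with prime⇒irreducible q-prime (subst (d ∣_) (ℕₚ.*-identityʳ q) d∣q^1)
  ... | inj₁ refl = inj₂ ℕᵈ.∣-refl
  ... | inj₂ refl = inj₁ (sym (ℕₚ.*-identityʳ q))
  ∣prime^suc⇒≡⊎∣ {q} {d} q-prime (suc k) d∣q^[2+k] with q ∣? d
  ... | no q∤d = inj₂ (coprime-divisor (Coprimality.sym (prime∤⇒coprime q-prime q∤d)) d∣q^[2+k])
  ... | yes (divides d′ refl)
      with ∣prime^suc⇒≡⊎∣ {d = d′} q-prime k (ℕᵈ.*-cancelʳ-∣ q {{prime⇒nonZero q-prime}}
                                       (subst (d′ ℕ.* q ∣_) (ℕₚ.*-comm q (q ℕ.^ suc k)) d∣q^[2+k]))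
  ... | inj₁ refl     = inj₁ (ℕₚ.*-comm (q ℕ.^ suc k) q)
  ... | inj₂ d′∣q^k   = inj₂ (subst (d′ ℕ.* q ∣_) (ℕₚ.*-comm (q ℕ.^ k) q) (ℕᵈ.*-monoˡ-∣ q d′∣q^k))

  coprime-prime^ : ∀ {q c} → Prime q → ¬ q ∣ c → ∀ k → Coprime c (q ℕ.^ k)
  coprime-prime^ q-prime q∤c zero    (_ , d∣1) = ℕᵈ.∣1⇒≡1 d∣1
  coprime-prime^ {q} q-prime q∤c (suc k) {d} (d∣c , d∣q^[1+k]) =
    coprime-prime^ q-prime q∤c k (d∣c , coprime-divisor d⊥q d∣q^[1+k])
    where
      d⊥q : Coprime d q
      d⊥q = Coprimality.sym (prime∤⇒coprime q-prime (λ q∣d → q∤c (ℕᵈ.∣-trans q∣d d∣c)))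

  prime-valuation : ∀ {q} → Prime q → ∀ m → 0 < m → ∃₂ λ k c → m ≡ c ℕ.* q ℕ.^ k × ¬ q ∣ c
  prime-valuation {q} q-prime = <-rec _ step
    where
      Valuation : ℕ → Set
      Valuation m = 0 < m → ∃₂ λ k c → m ≡ c ℕ.* q ℕ.^ k × ¬ q ∣ c
      step : ∀ m → (∀ {m′} → m′ < m → Valuation m′) → Valuation m
      step m rec 0<m with q ∣? m
      ... | no q∤m = 0 , m , sym (ℕₚ.*-identityʳ m) , q∤m
      ... | yes (divides m′ refl) with rec m′<m 0<m′
        where
          0<m′ : 0 < m′
          0<m′ = ℕ.>-nonZero⁻¹ m′ {{ℕₚ.m*n≢0⇒m≢0 m′ {{ℕ.>-nonZero 0<m}}}}
          m′<m : m′ < m′ ℕ.* q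
          m′<m = ℕₚ.m<m*n m′ q {{ℕ.>-nonZero 0<m′}} (ℕ.nonTrivial⇒n>1 q {{prime⇒nonTrivial q-prime}})
      ... | k , c , refl , q∤c =
            suc k , c , trans (ℕₚ.*-assoc c (q ℕ.^ k) q) (cong (c ℕ.*_) (ℕₚ.*-comm (q ℕ.^ k) q)) , q∤c

  ∃-prime-factor : ∀ {m} → 1 < m → ∃ λ q → Prime q × q ∣ m
  ∃-prime-factor {m@(suc _)} 1<m with factorise m
  ... | record { factors = [] ; isFactorisation = m≡1 } = contradiction m≡1 (ℕₚ.>⇒≢ 1<m)
  ... | record { factors = q ∷ _ ; isFactorisation = m≡q*_ ; factorsPrime = q-prime ∷ _ } =
        q , q-prime , subst (q ∣_) (sym m≡q*_) (ℕᵈ.m∣m*n _)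

  prime⇒pred≢0 : ∀ {p′} → Prime (suc p′) → NonZero p′
  prime⇒pred≢0 {p′} p-prime = ℕ.>-nonZero (ℕₚ.≤-pred (ℕ.nonTrivial⇒n>1 (suc p′) {{prime⇒nonTrivial p-prime}}))

  module _ {p′ : ℕ} (p-prime : Prime (suc p′)) where

    private
      p : ℕ
      p = suc p′

      instance
        p′≢0 : NonZero p′
        p′≢0 = prime⇒pred≢0 p-prime

    -- (x^w)^(q^(k+1)) = x^p′ ≡ 1 by Fermat, and an order properly dividing q^(k+1) would
    -- divide q^k, making x a root of X^(p′/q) − 1.
    non-root⇒hasOrder : ∀ {q k w x} → Prime q → p′ ≡ w ℕ.* q ℕ.^ suc k → 0 < x → x < p →
                        ¬ (+ x) ^ (w ℕ.* q ℕ.^ k) ≡ 1ℤ mod p → (+ x) ^ w hasOrder q ℕ.^ suc k mod p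
    non-root⇒hasOrder {q} {k} {w} {x} q-prime p′≡w*Q 0<x x<p x^e≢1 = y^Q≡1 , least
      where
        Q : ℕ
        Q = q ℕ.^ suc k
        y : ℤ
        y = (+ x) ^ w
        y^≡ : ∀ t → y ^ t ≡ (+ x) ^ (w ℕ.* t)
        y^≡ t = ℤₚ.^-*-assoc (+ x) w t
        y^Q≡1 : y ^ Q ≡ 1ℤ mod p
        y^Q≡1 = subst (λ z → z ≡ 1ℤ mod p) (sym (trans (y^≡ Q) (cong ((+ x) ^_) (sym p′≡w*Q))))
                      (fermat-≡mod p-prime (<⇒≢0-mod 0<x x<p))
        least : ∀ t → y ^ t ≡ 1ℤ mod p → Q ∣ t
        least t y^t≡1 with ∣prime^suc⇒≡⊎∣ q-prime k (gcd[m,n]∣n t Q)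
        ... | inj₁ gcd≡Q    = subst (_∣ t) gcd≡Q (gcd[m,n]∣m t Q)
        ... | inj₂ gcd∣q^k  = contradiction
                (subst (λ z → z ≡ 1ℤ mod p) (y^≡ (q ℕ.^ k)) (^≡1-∣ {r = y} {m = gcd t Q} (^≡1-gcd {r = y} {s = t} {t = Q} y^t≡1 y^Q≡1) gcd∣q^k))
                x^e≢1

    ∃-hasOrder-prime^ : ∀ {q k} → Prime q → q ℕ.^ suc k ∣ p′ → ∃ λ y → y hasOrder q ℕ.^ suc k mod p
    ∃-hasOrder-prime^ {q} {k} q-prime (divides w p′≡w*Q) with ∃-non-root-of-unity p-prime (ℕ.>-nonZero⁻¹ e) e<p′
      where
        e : ℕ
        e = w ℕ.* q ℕ.^ k
        p′≡e*q : p′ ≡ e ℕ.* q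
        p′≡e*q = trans p′≡w*Q (trans (cong (w ℕ.*_) (ℕₚ.*-comm q (q ℕ.^ k))) (sym (ℕₚ.*-assoc w (q ℕ.^ k) q)))
        instance
          e≢0 : NonZero e
          e≢0 = ℕₚ.m*n≢0⇒m≢0 e {{subst NonZero p′≡e*q p′≢0}}
        e<p′ : e < p′
        e<p′ = subst (e <_) (sym p′≡e*q) (ℕₚ.m<m*n e q (ℕ.nonTrivial⇒n>1 q {{prime⇒nonTrivial q-prime}}))
    ... | x , 0<x , x<p , x^e≢1 = (+ x) ^ w , non-root⇒hasOrder {k = k} {w = w} q-prime p′≡w*Q 0<x x<p x^e≢1

    ∃-hasOrder : ∀ m → m ∣ p′ → ∃ λ r → r hasOrder m mod p
    ∃-hasOrder = <-rec _ step
      where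
        HasElementOfOrder : ℕ → Set
        HasElementOfOrder m = ∃ λ r → r hasOrder m mod p
        combine : ∀ {q k c} → Prime q → ¬ q ∣ c → HasElementOfOrder c → c ℕ.* q ℕ.^ suc k ∣ p′ →
                  HasElementOfOrder (c ℕ.* q ℕ.^ suc k)
        combine {q} {k} {c} q-prime q∤c (r , r-order) cQ∣p′ =
          r * proj₁ y-elt , hasOrder-* {a = r} {b = proj₁ y-elt} {s = c} {t = q ℕ.^ suc k} r-order (proj₂ y-elt) c⊥Q
          where
            c⊥Q : Coprime c (q ℕ.^ suc k)
            c⊥Q = coprime-prime^ q-prime q∤c (suc k)
            y-elt : ∃ λ y → y hasOrder q ℕ.^ suc k mod p
            y-elt = ∃-hasOrder-prime^ {k = k} q-prime (ℕᵈ.∣-trans (ℕᵈ.n∣m*n c) cQ∣p′)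
        step : ∀ m → (∀ {m′} → m′ < m → m′ ∣ p′ → HasElementOfOrder m′) → m ∣ p′ → HasElementOfOrder m
        step zero          _   0∣p′ = contradiction (ℕᵈ.0∣⇒≡0 0∣p′) (ℕ.≢-nonZero⁻¹ p′)
        step (suc zero)    _   _    = 1ℤ , ≡mod-refl , λ t _ → ℕᵈ.1∣ t
        step m@(suc (suc _)) rec m∣p′ with q , q-prime , q∣m ← ∃-prime-factor {m} (s≤s (s≤s z≤n))
                                     with prime-valuation q-prime m z<s
        ... | zero  , c , m≡c*1 , q∤c = contradiction (subst (q ∣_) (trans m≡c*1 (ℕₚ.*-identityʳ c)) q∣m) q∤c
        ... | suc k , c , m≡c*Q , q∤c =
              subst HasElementOfOrder (sym m≡c*Q)
                (combine {k = k} q-prime q∤c (rec c<m (ℕᵈ.∣-trans (ℕᵈ.m∣m*n _) cQ∣p′)) cQ∣p′)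
          where
            cQ∣p′ : c ℕ.* q ℕ.^ suc k ∣ p′
            cQ∣p′ = subst (_∣ p′) m≡c*Q m∣p′
            instance
              c≢0 : NonZero c
              c≢0 = ℕₚ.m*n≢0⇒m≢0 c {{subst NonZero m≡c*Q _}}
              q≢0 : NonZero q
              q≢0 = prime⇒nonZero q-prime
            c<m : c < m
            c<m = subst (c <_) (sym m≡c*Q) (ℕₚ.m<m*n c (q ℕ.^ suc k)
                    (ℕₚ.<-≤-trans (ℕ.nonTrivial⇒n>1 q {{prime⇒nonTrivial q-prime}}) (ℕₚ.m≤m*n q (q ℕ.^ k) {{ℕₚ.m^n≢0 q k}})))

    primitive-root : ∃ λ r → r hasOrder p′ mod p
    primitive-root = ∃-hasOrder p′ ℕᵈ.∣-refl

    module _ {r : ℤ} (r-order : r hasOrder p′ mod p) where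
      open SetoidReasoning (≡mod-setoid {p})

      ^-≢0 : ∀ i → ¬ r ^ i ≡ 0ℤ mod p
      ^-≢0 i r^i≡0 = 1≢0-mod p-prime (begin
        1ℤ                 ≈⟨ ^≡1-∣ {r = r} {m = p′} (proj₁ r-order) (ℕᵈ.n∣m*n i) ⟨
        r ^ (i ℕ.* p′)     ≡⟨ ℤₚ.^-*-assoc r i p′ ⟨
        (r ^ i) ^ p′       ≈⟨ ^-cong-≡mod r^i≡0 p′ ⟩
        0ℤ ^ p′            ≡⟨ 0^n≡0 p′ ⟩
        0ℤ                 ∎)

      private
        ^-split : ∀ {i j} → j ≤ i → r ^ i ≡ r ^ j * r ^ (i ℕ.∸ j)
        ^-split {i} {j} j≤i = trans (cong (r ^_) (sym (ℕₚ.m+[n∸m]≡n j≤i))) (ℤₚ.^-distribˡ-+-* r j (i ℕ.∸ j))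

        ≡mod⇒^≡^-≤ : ∀ {i j} → j ≤ i → + i ≡ + j mod p′ → r ^ i ≡ r ^ j mod p
        ≡mod⇒^≡^-≤ {i} {j} j≤i i≡j = begin
          r ^ i                    ≡⟨ ^-split j≤i ⟩
          r ^ j * r ^ (i ℕ.∸ j)    ≈⟨ *-cong-≡mod {a = r ^ j} ≡mod-refl (^≡1-∣ {r = r} {m = p′} (proj₁ r-order) (≡mod⇒∣∸ j≤i i≡j)) ⟩
          r ^ j * 1ℤ               ≡⟨ ℤₚ.*-identityʳ (r ^ j) ⟩
          r ^ j                    ∎

        ^≡^⇒≡mod-≤ : ∀ {i j} → j ≤ i → r ^ i ≡ r ^ j mod p → + i ≡ + j mod p′
        ^≡^⇒≡mod-≤ {i} {j} j≤i r^i≡r^j = ∣∸⇒≡mod j≤i (proj₂ r-order (i ℕ.∸ j) r^[i∸j]≡1)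
          where
            r^[i∸j]≡1 : r ^ (i ℕ.∸ j) ≡ 1ℤ mod p
            r^[i∸j]≡1 = *-cancelˡ-≡mod {k = r ^ j} (≢0-mod⇒coprime p-prime (^-≢0 j)) (begin
              r ^ j * r ^ (i ℕ.∸ j)  ≡⟨ ^-split j≤i ⟨
              r ^ i                  ≈⟨ r^i≡r^j ⟩
              r ^ j                  ≡⟨ ℤₚ.*-identityʳ (r ^ j) ⟨
              r ^ j * 1ℤ             ∎)

      ≡mod⇒^≡^ : ∀ {i j} → + i ≡ + j mod p′ → r ^ i ≡ r ^ j mod p
      ≡mod⇒^≡^ {i} {j} i≡j with ℕₚ.≤-total j i
      ... | inj₁ j≤i = ≡mod⇒^≡^-≤ j≤i i≡j
      ... | inj₂ i≤j = ≡mod-sym (≡mod⇒^≡^-≤ i≤j (≡mod-sym i≡j))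

      ^≡^⇒≡mod : ∀ {i j} → r ^ i ≡ r ^ j mod p → + i ≡ + j mod p′
      ^≡^⇒≡mod {i} {j} r^i≡r^j with ℕₚ.≤-total j i
      ... | inj₁ j≤i = ^≡^⇒≡mod-≤ j≤i r^i≡r^j
      ... | inj₂ i≤j = ≡mod-sym (^≡^⇒≡mod-≤ i≤j (≡mod-sym r^i≡r^j))

module Multisets where

  open import Data.Nat using (zero; suc; _≤_)
  import Data.Nat.Properties as ℕₚ
  open import Data.Fin using (Fin; zero; suc)
  import Data.Fin.Properties as Finₚ
  open import Data.Bool using (true; false)
  open import Data.List using (List; []; _∷_; [_]; map; _++_; length; filter; lookup)
  import Data.List.Properties as Listₚ
  open import Data.List.Relation.Unary.All as All using (All; []; _∷_)
  import Data.List.Relation.Unary.All.Properties as Allₚ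
  open import Data.List.Relation.Unary.AllPairs using (AllPairs; []; _∷_)
  open import Data.List.Relation.Unary.Unique.Propositional using (Unique)
  import Data.List.Relation.Unary.Unique.Propositional.Properties as Uniqueₚ
  open import Data.List.Membership.Propositional using (_∈_)
  open import Data.List.Membership.Propositional.Properties using (∈-map⁻; ∈-lookup)
  open import Data.List.Relation.Unary.Any using (here; there)
  open import Data.Product using (∃₂; _×_; _,_)
  open import Data.Empty using (⊥)
  open import Function using (_∘_)
  open import Relation.Nullary using (yes; no; does; contradiction)
  open import Relation.Unary using (Pred; Decidable)
  open import Relation.Binary using (Rel; Reflexive)
  open import Relation.Binary.PropositionalEquality hiding ([_])

  open import Defs using (multisets)

  length-filter-map : ∀ {A B : Set} {ℓ} {P : Pred B ℓ} (P? : Decidable P) (f : A → B) xs →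
                      length (filter P? (map f xs)) ≡ length (filter (P? ∘ f) xs)
  length-filter-map P? f []       = refl
  length-filter-map P? f (x ∷ xs) with does (P? (f x))
  ... | true  = cong suc (length-filter-map P? f xs)
  ... | false = length-filter-map P? f xs

  multisets-map : ∀ {A B : Set} (f : A → B) h xs → multisets h (map f xs) ≡ map (map f) (multisets h xs)
  multisets-map f zero    xs       = refl
  multisets-map f (suc h) []       = refl
  multisets-map {A} f (suc h) (x ∷ xs) = begin
    map (f x ∷_) (multisets h (map f (x ∷ xs))) ++ multisets (suc h) (map f xs)
      ≡⟨ cong₂ (λ ys zs → map (f x ∷_) ys ++ zs) (multisets-map f h (x ∷ xs)) (multisets-map f (suc h) xs) ⟩
    map (f x ∷_) (map (map f) ys) ++ map (map f) (multisets (suc h) xs)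
      ≡⟨ cong (_++ map (map f) (multisets (suc h) xs)) (trans (sym (Listₚ.map-∘ ys)) (Listₚ.map-∘ ys)) ⟩
    map (map f) (map (x ∷_) ys) ++ map (map f) (multisets (suc h) xs)
      ≡⟨ Listₚ.map-++ (map f) (map (x ∷_) ys) (multisets (suc h) xs) ⟨
    map (map f) (map (x ∷_) ys ++ multisets (suc h) xs)
      ∎
    where
      open ≡-Reasoning
      ys : List (List A)
      ys = multisets h (x ∷ xs)

  module _ {A : Set} where

    multisets-⊆ : ∀ h (xs : List A) → All (All (_∈ xs)) (multisets h xs)
    multisets-⊆ zero    xs       = [] ∷ []
    multisets-⊆ (suc h) []       = []
    multisets-⊆ (suc h) (x ∷ xs) =
      Allₚ.++⁺ (Allₚ.map⁺ (All.map (here refl ∷_) (multisets-⊆ h (x ∷ xs))))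
               (All.map (All.map there) (multisets-⊆ (suc h) xs))

    multisets-unique : ∀ h {xs : List A} → Unique xs → Unique (multisets h xs)
    multisets-unique zero    _                        = [] ∷ []
    multisets-unique (suc h) {[]}     _               = []
    multisets-unique (suc h) {x ∷ xs} x∷xs-unique@(_ ∷ xs-unique) =
      Uniqueₚ.++⁺ (Uniqueₚ.map⁺ (λ { refl → refl }) (multisets-unique h x∷xs-unique))
                  (multisets-unique (suc h) xs-unique)
                  disjoint
      where
        disjoint : ∀ {v} → v ∈ map (x ∷_) (multisets h (x ∷ xs)) × v ∈ multisets (suc h) xs → ⊥
        disjoint (v∈₁ , v∈₂) with ∈-map⁻ (x ∷_) v∈₁
        ... | _ , _ , refl with All.lookup (multisets-⊆ (suc h) xs) v∈₂
        ... | x∈xs ∷ _ = Uniqueₚ.Unique[x∷xs]⇒x∉xs x∷xs-unique x∈xs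

    multisets-1 : ∀ (xs : List A) → multisets 1 xs ≡ map [_] xs
    multisets-1 []       = refl
    multisets-1 (x ∷ xs) = cong ([ x ] ∷_) (multisets-1 xs)

    multisets-2-ordered : ∀ {ℓ} {R : Rel A ℓ} → Reflexive R → ∀ {xs} → AllPairs R xs →
                          All (λ u → ∃₂ λ x y → u ≡ x ∷ y ∷ [] × R x y) (multisets 2 xs)
    multisets-2-ordered R-refl {[]}     []           = []
    multisets-2-ordered R-refl {x ∷ xs} (R[x] ∷ R-xs) =
      Allₚ.++⁺ (Allₚ.map⁺ (subst (All _) (sym (multisets-1 (x ∷ xs)))
                                   (Allₚ.map⁺ (All.map (λ {y} Rxy → x , y , refl , Rxy) (R-refl ∷ R[x])))))
               (multisets-2-ordered R-refl R-xs)

    Unique-lookup-injective : ∀ {xs : List A} → Unique xs → ∀ {i j} → lookup xs i ≡ lookup xs j → i ≡ j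
    Unique-lookup-injective (_   ∷ _)  {zero}  {zero}  _  = refl
    Unique-lookup-injective (x≢ ∷ _)  {zero}  {suc j} x≡ = contradiction x≡ (All.lookup x≢ (∈-lookup j))
    Unique-lookup-injective (x≢ ∷ _)  {suc i} {zero}  ≡x = contradiction (sym ≡x) (All.lookup x≢ (∈-lookup i))
    Unique-lookup-injective (_  ∷ u)  {suc i} {suc j} e  = cong suc (Unique-lookup-injective u e)

    length≤-injectiveOn : ∀ {n} (K : A → Fin n) {xs} → Unique xs →
                          (∀ {u v} → u ∈ xs → v ∈ xs → K u ≡ K v → u ≡ v) → length xs ≤ n
    length≤-injectiveOn {n} K {xs} xs-unique K-injective with length xs ℕₚ.≤? n
    ... | yes |xs|≤n = |xs|≤n
    ... | no  |xs|≰n with i , j , i<j , Ki≡Kj ← Finₚ.pigeonhole (ℕₚ.≰⇒> |xs|≰n) (K ∘ lookup xs) =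
      contradiction (Unique-lookup-injective xs-unique (K-injective (∈-lookup i) (∈-lookup j) Ki≡Kj)) (Finₚ.<⇒≢ i<j)

module Construction where

  open import Data.Nat as ℕ using (ℕ; suc; NonZero; _<_; _≤_; s≤s)
  import Data.Nat.Properties as ℕₚ
  open import Data.Nat.Divisibility as ℕᵈ using (_∣_)
  open import Data.Nat.DivMod using (_%_; _/_; m/n*n≡m; m%n<n; m<n*o⇒m/o<n)
  open import Data.Nat.Coprimality as Coprimality using (Coprime; prime⇒coprime)
  open import Data.Nat.Primality using (Prime)
  open import Data.Nat.ListAction using (sum)
  open import Data.Integer using (ℤ; +_; _+_; _*_; _^_)
  import Data.Integer.Properties as ℤₚ
  open import Data.Integer.Tactic.RingSolver using (solve-∀)
  open import Data.Integer.DivMod using (_%ℕ_)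
  open import Data.Fin using (Fin; toℕ; fromℕ<)
  import Data.Fin.Properties as Finₚ
  open import Data.Bool using (T)
  open import Data.Bool.Properties using (T?)
  open import Data.List using (List; []; _∷_; map; length; filter; upTo)
  import Data.List.Properties as Listₚ
  open import Data.List.Relation.Unary.All as All using ([]; _∷_)
  open import Data.List.Relation.Unary.AllPairs using (AllPairs)
  import Data.List.Relation.Unary.AllPairs.Properties as AllPairsₚ
  open import Data.List.Relation.Unary.Unique.Propositional using (Unique)
  import Data.List.Relation.Unary.Unique.Propositional.Properties as Uniqueₚ
  open import Data.List.Membership.Propositional using (_∈_)
  open import Data.List.Membership.Propositional.Properties using (∈-filter⁻; ∈-upTo⁻)
  open import Data.Product using (∃₂; _×_; _,_; proj₁; proj₂)
  open import Data.Sum using (_⊎_; inj₁; inj₂)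
  open import Function using (_∘_)
  open import Relation.Unary using (Decidable)
  open import Relation.Binary.PropositionalEquality
  import Relation.Binary.Reasoning.Setoid as SetoidReasoning

  open import Defs
  open Congruence
  open Orders using (_hasOrder_mod_; prime⇒pred≢0; ≡mod⇒^≡^; ^≡^⇒≡mod)
  open Multisets

  sumsTo-sound : ∀ {N} (u : List (Fin N)) (b : Fin N) → T (sumsTo N u b) → + sum (map toℕ u) ≡ + toℕ b mod N
  sumsTo-sound {suc n} u b s≡b = ≡mod-trans (≡mod-sym (%-≡mod (sum (map toℕ u))))
                                            (≡mod-reflexive (cong +_ (ℕₚ.≡ᵇ⇒≡ _ (toℕ b) s≡b)))

  ordered-swap : ∀ {i j i′ j′} → i ≤ j → i′ ≤ j′ → i′ ≡ j → j′ ≡ i → i′ ≡ i × j′ ≡ j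
  ordered-swap {i} {j} i≤j i′≤j′ refl refl = sym i≡j , i≡j
    where
      i≡j : i ≡ j
      i≡j = ℕₚ.≤-antisym i≤j i′≤j′

  module _ {p′ : ℕ} (p-prime : Prime (suc p′)) {g : ℕ} .{{_ : NonZero g}} (g∣p′ : g ∣ p′)
           {r : ℤ} (r-order : r hasOrder p′ mod suc p′) where

    private
      p m N : ℕ
      p = suc p′
      m = p′ / g
      N = p ℕ.* m

      p′≡m*g : p′ ≡ m ℕ.* g
      p′≡m*g = sym (m/n*n≡m g∣p′)

      instance
        p′≢0 : NonZero p′
        p′≢0 = prime⇒pred≢0 p-prime
        m≢0 : NonZero m
        m≢0 = ℕₚ.m*n≢0⇒m≢0 m {{subst NonZero p′≡m*g p′≢0}}
        N≢0 : NonZero N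
        N≢0 = ℕₚ.m*n≢0 p m

      m∣p′ : m ∣ p′
      m∣p′ = subst (m ∣_) (sym p′≡m*g) (ℕᵈ.m∣m*n g)

      p⊥m : Coprime p m
      p⊥m = prime⇒coprime p-prime (s≤s (subst (m ≤_) (sym p′≡m*g) (ℕₚ.m≤m*n m g)))

    residue : ℕ → ℕ
    residue i = (r ^ i) %ℕ p

    element : ℕ → Fin N
    element i = fromℕ< (m%n<n (m ℕ.* residue i ℕ.+ p ℕ.* i) N)

    boseSet : List (Fin N)
    boseSet = map element (upTo p′)

    key : ℕ → Fin g
    key s = fromℕ< (m<n*o⇒m/o<n (subst (s % p′ <_) (trans p′≡m*g (ℕₚ.*-comm m g)) (m%n<n s p′)))

    element-≡mod : ∀ i → + toℕ (element i) ≡ + m * + residue i + + p * + i mod N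
    element-≡mod i = ≡mod-trans (≡mod-reflexive (cong +_ (Finₚ.toℕ-fromℕ< _))) (≡mod-trans (%-≡mod v)
                       (≡mod-reflexive (trans (ℤₚ.pos-+ (m ℕ.* residue i) (p ℕ.* i))
                                              (cong₂ _+_ (ℤₚ.pos-* m (residue i)) (ℤₚ.pos-* p i)))))
      where
        v : ℕ
        v = m ℕ.* residue i ℕ.+ p ℕ.* i

    crt-decode : ∀ {u u′ s s′} → + m * u + + p * s ≡ + m * u′ + + p * s′ mod N → u ≡ u′ mod p × s ≡ s′ mod m
    crt-decode {u} {u′} {s} {s′} eq = mod-p , mod-m
      where
        mod-p : u ≡ u′ mod p
        mod-p = *-cancelˡ-≡mod {k = + m} p⊥m (begin
          + m * u                      ≈⟨ +-multiple-≡mod (+ m * u) s ⟨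
          + m * u + + p * s            ≈⟨ ≡mod-∣ (ℕᵈ.m∣m*n m) eq ⟩
          + m * u′ + + p * s′          ≈⟨ +-multiple-≡mod (+ m * u′) s′ ⟩
          + m * u′                     ∎)
          where open SetoidReasoning (≡mod-setoid {p})
        mod-m : s ≡ s′ mod m
        mod-m = *-cancelˡ-≡mod {k = + p} (Coprimality.sym p⊥m) (begin
          + p * s                      ≈⟨ +-multiple-≡mod (+ p * s) u ⟨
          + p * s + + m * u            ≡⟨ ℤₚ.+-comm (+ p * s) (+ m * u) ⟩
          + m * u + + p * s            ≈⟨ ≡mod-∣ (ℕᵈ.n∣m*n p) eq ⟩
          + m * u′ + + p * s′          ≡⟨ ℤₚ.+-comm (+ m * u′) (+ p * s′) ⟩
          + p * s′ + + m * u′          ≈⟨ +-multiple-≡mod (+ p * s′) u′ ⟩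
          + p * s′                     ∎)
          where open SetoidReasoning (≡mod-setoid {m})

    residue-≡mod : ∀ i → + residue i ≡ r ^ i mod p
    residue-≡mod i = %ℕ-≡mod (r ^ i)

    log-injective : ∀ {i j} → i < p′ → j < p′ → r ^ i ≡ r ^ j mod p → i ≡ j
    log-injective i<p′ j<p′ r^i≡r^j = ≡mod⇒≡ i<p′ j<p′ (^≡^⇒≡mod p-prime r-order r^i≡r^j)

    private
      A : ℕ → ℕ
      A i = toℕ (element i)

    pair-≡mod : ∀ i j → + (A i ℕ.+ A j) ≡ + m * (+ residue i + + residue j) + + p * + (i ℕ.+ j) mod N
    pair-≡mod i j = begin
      + (A i ℕ.+ A j)                                                   ≡⟨ ℤₚ.pos-+ (A i) (A j) ⟩
      + A i + + A j                                                     ≈⟨ +-cong-≡mod (element-≡mod i) (element-≡mod j) ⟩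
      (+ m * + residue i + + p * + i) + (+ m * + residue j + + p * + j) ≡⟨ lemma (+ m) (+ p) (+ residue i) (+ residue j) (+ i) (+ j) ⟩
      + m * (+ residue i + + residue j) + + p * (+ i + + j)             ≡⟨ cong (λ s → + m * (+ residue i + + residue j) + + p * s) (ℤₚ.pos-+ i j) ⟨
      + m * (+ residue i + + residue j) + + p * + (i ℕ.+ j)             ∎
      where
        open SetoidReasoning (≡mod-setoid {N})
        lemma : ∀ m p a b x y → (m * a + p * x) + (m * b + p * y) ≡ m * (a + b) + p * (x + y)
        lemma = solve-∀

    pair-decode : ∀ {i j i′ j′} → + (A i ℕ.+ A j) ≡ + (A i′ ℕ.+ A j′) mod N →
                  r ^ i + r ^ j ≡ r ^ i′ + r ^ j′ mod p × + (i ℕ.+ j) ≡ + (i′ ℕ.+ j′) mod m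
    pair-decode {i} {j} {i′} {j′} sums≡ = powers≡ , proj₂ decoded
      where
        open SetoidReasoning (≡mod-setoid {p})
        decoded : + residue i + + residue j ≡ + residue i′ + + residue j′ mod p × + (i ℕ.+ j) ≡ + (i′ ℕ.+ j′) mod m
        decoded = crt-decode (≡mod-trans (≡mod-sym (pair-≡mod i j)) (≡mod-trans sums≡ (pair-≡mod i′ j′)))
        powers≡ : r ^ i + r ^ j ≡ r ^ i′ + r ^ j′ mod p
        powers≡ = begin
          r ^ i + r ^ j                  ≈⟨ +-cong-≡mod (residue-≡mod i) (residue-≡mod j) ⟨
          + residue i + + residue j      ≈⟨ proj₁ decoded ⟩
          + residue i′ + + residue j′    ≈⟨ +-cong-≡mod (residue-≡mod i′) (residue-≡mod j′) ⟩
          r ^ i′ + r ^ j′                ∎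

    element-injective : ∀ {i j} → i < p′ → j < p′ → element i ≡ element j → i ≡ j
    element-injective {i} {j} i<p′ j<p′ eq =
      log-injective i<p′ j<p′ (begin
        r ^ i           ≈⟨ residue-≡mod i ⟨
        + residue i     ≈⟨ proj₁ (crt-decode elements≡) ⟩
        + residue j     ≈⟨ residue-≡mod j ⟩
        r ^ j           ∎)
      where
        open SetoidReasoning (≡mod-setoid {p})
        elements≡ : + m * + residue i + + p * + i ≡ + m * + residue j + + p * + j mod N
        elements≡ = ≡mod-trans (≡mod-sym (element-≡mod i)) (subst (λ a → + toℕ a ≡ _ mod N) (sym eq) (element-≡mod j))

    key-injective : ∀ {s s′} → + s ≡ + s′ mod m → key s ≡ key s′ → + s ≡ + s′ mod p′
    key-injective {s} {s′} s≡s′ keys≡ = begin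
      + s              ≈⟨ %-≡mod s ⟨
      + (s % p′)       ≡⟨ cong +_ (≡mod∧/≡⇒≡ remainders≡ (Finₚ.fromℕ<-injective _ _ _ _ keys≡)) ⟩
      + (s′ % p′)      ≈⟨ %-≡mod s′ ⟩
      + s′             ∎
      where
        open SetoidReasoning (≡mod-setoid {p′})
        remainders≡ : + (s % p′) ≡ + (s′ % p′) mod m
        remainders≡ = ≡mod-trans (≡mod-∣ m∣p′ (%-≡mod s))
                        (≡mod-trans s≡s′ (≡mod-sym (≡mod-∣ m∣p′ (%-≡mod s′))))

    pair-injective : ∀ {i j i′ j′} → i ≤ j → j < p′ → i′ ≤ j′ → j′ < p′ →
                     + (A i ℕ.+ A j) ≡ + (A i′ ℕ.+ A j′) mod N → key (i ℕ.+ j) ≡ key (i′ ℕ.+ j′) →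
                     i′ ≡ i × j′ ≡ j
    pair-injective {i} {j} {i′} {j′} i≤j j<p′ i′≤j′ j′<p′ sums≡ keys≡ =
      same-pair (vieta-≡mod p-prime (proj₁ (pair-decode sums≡)) products≡)
      where
        open SetoidReasoning (≡mod-setoid {p})
        products≡ : r ^ i * r ^ j ≡ r ^ i′ * r ^ j′ mod p
        products≡ = begin
          r ^ i * r ^ j         ≡⟨ ℤₚ.^-distribˡ-+-* r i j ⟨
          r ^ (i ℕ.+ j)         ≈⟨ ≡mod⇒^≡^ p-prime r-order (key-injective (proj₂ (pair-decode sums≡)) keys≡) ⟩
          r ^ (i′ ℕ.+ j′)       ≡⟨ ℤₚ.^-distribˡ-+-* r i′ j′ ⟩
          r ^ i′ * r ^ j′       ∎
        i<p′ : i < p′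
        i<p′ = ℕₚ.≤-<-trans i≤j j<p′
        i′<p′ : i′ < p′
        i′<p′ = ℕₚ.≤-<-trans i′≤j′ j′<p′
        same-pair : (r ^ i′ ≡ r ^ i mod p × r ^ j′ ≡ r ^ j mod p) ⊎ (r ^ i′ ≡ r ^ j mod p × r ^ j′ ≡ r ^ i mod p) →
                    i′ ≡ i × j′ ≡ j
        same-pair (inj₁ (i′≡i , j′≡j)) = log-injective i′<p′ i<p′ i′≡i , log-injective j′<p′ j<p′ j′≡j
        same-pair (inj₂ (i′≡j , j′≡i)) = ordered-swap i≤j i′≤j′ (log-injective i′<p′ j<p′ i′≡j) (log-injective j′<p′ i<p′ j′≡i)

    private
      pairs : List (List ℕ)
      pairs = multisets 2 (upTo p′)

      sum-pair : ∀ x y → sum (x ∷ y ∷ []) ≡ x ℕ.+ y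
      sum-pair x y = cong (x ℕ.+_) (ℕₚ.+-identityʳ y)

    ordered-pair : ∀ {u} → u ∈ pairs → ∃₂ λ i j → u ≡ i ∷ j ∷ [] × i ≤ j × j < p′
    ordered-pair u∈ with All.lookup (multisets-2-ordered ℕₚ.≤-refl upTo-ordered) u∈
                       | All.lookup (multisets-⊆ 2 (upTo p′)) u∈
      where
        upTo-ordered : AllPairs _≤_ (upTo p′)
        upTo-ordered = AllPairsₚ.applyUpTo⁺₁ _ p′ (λ i<j _ → ℕₚ.<⇒≤ i<j)
    ... | i , j , refl , i≤j | _ ∷ j∈ ∷ [] = i , j , refl , i≤j , ∈-upTo⁻ j∈

    representation-injective : ∀ {b u v} → u ∈ pairs → v ∈ pairs →
                               T (sumsTo N (map element u) b) → T (sumsTo N (map element v) b) →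
                               key (sum u) ≡ key (sum v) → u ≡ v
    representation-injective {b} u∈ v∈ u↦b v↦b keys≡
      with i , j , refl , i≤j , j<p′ ← ordered-pair u∈
         | i′ , j′ , refl , i′≤j′ , j′<p′ ← ordered-pair v∈ =
      cong₂ (λ x y → x ∷ y ∷ []) (sym (proj₁ same)) (sym (proj₂ same))
      where
        sums≡ : + (A i ℕ.+ A j) ≡ + (A i′ ℕ.+ A j′) mod N
        sums≡ = subst₂ (λ s s′ → + s ≡ + s′ mod N) (sum-pair (A i) (A j)) (sum-pair (A i′) (A j′))
                  (≡mod-trans (sumsTo-sound _ b u↦b) (≡mod-sym (sumsTo-sound _ b v↦b)))
        same : i′ ≡ i × j′ ≡ j
        same = pair-injective i≤j j<p′ i′≤j′ j′<p′ sums≡ (subst₂ (λ s s′ → key s ≡ key s′) (sum-pair i j) (sum-pair i′ j′) keys≡)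

    boseSet-unique : Unique boseSet
    boseSet-unique = AllPairsₚ.map⁺ (AllPairsₚ.applyUpTo⁺₁ _ p′ λ i<j j<p′ elements≡ →
      ℕₚ.<⇒≢ i<j (element-injective (ℕₚ.<-trans i<j j<p′) j<p′ elements≡))

    length-boseSet : length boseSet ≡ p′
    length-boseSet = trans (Listₚ.length-map element (upTo p′)) (Listₚ.length-upTo p′)

    boseSet-B₂[g] : IsBhg N 2 g boseSet
    boseSet-B₂[g] b = begin
      reps N 2 boseSet b                                  ≡⟨ cong (length ∘ filter represents?) (multisets-map element 2 (upTo p′)) ⟩
      length (filter represents? (map (map element) pairs)) ≡⟨ length-filter-map represents? (map element) pairs ⟩
      length (filter (represents? ∘ map element) pairs)   ≤⟨ length≤-injectiveOn (key ∘ sum) unique injective ⟩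
      g                                                   ∎
      where
        open ℕₚ.≤-Reasoning
        represents? : Decidable (λ u → T (sumsTo N u b))
        represents? u = T? (sumsTo N u b)
        unique : Unique (filter (represents? ∘ map element) pairs)
        unique = Uniqueₚ.filter⁺ _ (multisets-unique 2 (Uniqueₚ.upTo⁺ p′))
        injective : ∀ {u v} → u ∈ filter (represents? ∘ map element) pairs → v ∈ filter (represents? ∘ map element) pairs →
                    key (sum u) ≡ key (sum v) → u ≡ v
        injective u∈ v∈ = representation-injective {b} (proj₁ (member u∈)) (proj₁ (member v∈))
                                                       (proj₂ (member u∈)) (proj₂ (member v∈))
          where
            member : ∀ {u} → u ∈ filter (represents? ∘ map element) pairs → u ∈ pairs × T (sumsTo N (map element u) b)
            member = ∈-filter⁻ (represents? ∘ map element)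

open import Defs
open import Data.Nat using (ℕ; zero; suc; _+_; _*_; _∸_; _≤_; NonZero)
import Data.Nat.Properties as ℕₚ
open import Data.Nat.DivMod using (_/_; *-/-assoc)
open import Data.Nat.Divisibility using (_∣_)
open import Data.Nat.Primality using (Prime)
open import Data.Fin using (Fin)
open import Data.List using (List; length)
open import Data.List.Relation.Unary.Unique.Propositional using (Unique)
open import Data.Product using (Σ; _×_; _,_)
open import Relation.Binary.PropositionalEquality

open Orders using (primitive-root)
open Construction using (boseSet; boseSet-unique; length-boseSet; boseSet-B₂[g])

corollary3p2 : (g p : ℕ) → .{{_ : NonZero g}} → Prime p → g ∣ (p ∸ 1) →
    Σ (List (Fin ((p * p ∸ p) / g))) (λ A →
      Unique A × (p ∸ 1 ≤ length A) × IsBhg ((p * p ∸ p) / g) 2 g A)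
corollary3p2 g zero    ()
corollary3p2 g p@(suc p′) p-prime g∣p′ with r , r-order ← primitive-root p-prime =
  subst (λ N → Σ (List (Fin N)) λ A → Unique A × (p′ ≤ length A) × IsBhg N 2 g A) (sym N≡p*m)
    (boseSet p-prime g∣p′ r-order ,
     boseSet-unique p-prime g∣p′ r-order ,
     ℕₚ.≤-reflexive (sym (length-boseSet p-prime g∣p′ r-order)) ,
     boseSet-B₂[g] p-prime g∣p′ r-order)
  where
    N≡p*m : (p * p ∸ p) / g ≡ p * (p′ / g)
    N≡p*m = begin
      (p * p ∸ p) / g        ≡⟨ cong (λ x → (x ∸ p) / g) (ℕₚ.*-suc p p′) ⟩
      (p + p * p′ ∸ p) / g   ≡⟨ cong (_/ g) (ℕₚ.m+n∸m≡n p (p * p′)) ⟩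
      (p * p′) / g           ≡⟨ *-/-assoc p g∣p′ ⟩
      p * (p′ / g)           ∎
      where open ≡-Reasoning
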